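{- Let $F$ be an edge-ordered star forest with $k>1$ components. Then for every positive integer $n$, $$\mathrm{ex}_<(n,F)\le (k-1)\,\mathrm{ex}_{DS}(n,w'(F)).$$
   Context: Edge-ordered graph: finite simple graph with a linear order on its edges; isomorphisms preserve order; subgraphs carry induced order; $\mathrm{ex}_<(n,F)$ is the maximum number of edges of an edge-ordered graph on $n$ vertices with no subgraph isomorphic to $F$. A star forest is a non-empty graph all of whose components are stars. Words: a word is a finite sequence of letters. Words $a_1\dots a_n$ and $b_1\dots b_m$ are equivalent if $n=m$ and $a_i=a_j\iff b_i=b_j$ for all $i,j$. $|u|$ is the length and $\|u\|$ the number of distinct letters of $u$. $u$ is $k$-regular if every $k$ consecutive letters are distinct (if $|u|<k$, all letters distinct). A subword is obtained by deleting letters; $u$ contains $f$ if some subword of $u$ is equivalent to $f$, otherwise $u$ avoids $f$. For a non-empty word $f$, $\mathrm{ex}_{DS}(n,f)$ is the maximum length of an $\|f\|$-regular word $u$ with $\|u\|\le n$ avoiding $f$. For an edge-ordered star forest $F$ with $m$ edges, assign a distinct letter to each component; $w(F)=a_1\dots a_m$ where $a_i$ is the letter of the component containing the $i$-th smallest edge, and $w'(F)=a_1^{2m}\dots a_m^{2m}$ (each letter repeated $2m$ times). -}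

module Defs where

open import Data.Nat as ℕ using (ℕ; _*_)
open import Data.Fin as Fin using (Fin; toℕ; cast)
open import Data.Product using (Σ; ∃; _×_; _,_; proj₁; proj₂)
open import Data.Sum using (_⊎_)
open import Data.List using (List; length; lookup; map; concatMap; replicate; take; drop; deduplicate)
open import Data.List.Membership.Propositional using (_∈_)
open import Data.List.Relation.Unary.All using (All)
open import Data.List.Relation.Unary.Unique.Propositional using (Unique)
open import Data.List.Relation.Binary.Sublist.Propositional using (_⊆_)
open import Relation.Binary.PropositionalEquality using (_≡_)
open import Relation.Nullary using (¬_)
open import Function.Bundles using (_⇔_)
open import Function.Definitions using (Injective)

-- Edge-ordered graphs on the vertex set Fin n.
-- An edge {u,v} is stored as the pair (u , v) with u < v; the linear
-- order on edges is the order of the list (earlier = smaller).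

record EOGraph (n : ℕ) : Set where
  field
    edges    : List (Fin n × Fin n)
    simple   : All (λ e → proj₁ e Fin.< proj₂ e) edges
    distinct : Unique edges
open EOGraph public

e : ∀ {n} → EOGraph n → ℕ
e G = length (edges G)

record Embedding {p n : ℕ} (F : EOGraph p) (G : EOGraph n) : Set where
  field
    φ     : Fin p → Fin n
    φ-inj : Injective _≡_ _≡_ φ
    ψ     : Fin (length (edges F)) → Fin (length (edges G))
    ψ-mono : ∀ i j → i Fin.< j → ψ i Fin.< ψ j
    ψ-hit : ∀ i → let a = proj₁ (lookup (edges F) i)
                      b = proj₂ (lookup (edges F) i)
                  in (lookup (edges G) (ψ i) ≡ (φ a , φ b))
                     ⊎ (lookup (edges G) (ψ i) ≡ (φ b , φ a))

Contains : ∀ {n p} → EOGraph n → EOGraph p → Set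
Contains G F = Embedding F G

IsExOrd : ∀ {p} → ℕ → EOGraph p → ℕ → Set
IsExOrd n F m =
  (Σ (EOGraph n) λ G → ¬ Contains G F × e G ≡ m)
  × (∀ (G : EOGraph n) → ¬ Contains G F → e G ℕ.≤ m)

-- Star forests.  comp : Fin p → Fin k labels the vertices by component;
-- the conditions say that the classes of comp are exactly the connected
-- components of F, that there are exactly k of them, and that each is a
-- star with at least one edge.

record StarForest {p : ℕ} (F : EOGraph p) (k : ℕ) (comp : Fin p → Fin k) : Set where
  field
    surj        : ∀ c → ∃ λ v → comp v ≡ c
    noIsolated  : ∀ v → ∃ λ w → ((v , w) ∈ edges F) ⊎ ((w , v) ∈ edges F)
    sameComp    : ∀ {a b} → (a , b) ∈ edges F → comp a ≡ comp b
    center      : ∀ c → ∃ λ z → comp z ≡ c ×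
                    (∀ {a b} → (a , b) ∈ edges F → comp a ≡ c → (a ≡ z ⊎ b ≡ z))

Word : Set
Word = List ℕ

∥_∥ : Word → ℕ
∥ u ∥ = length (deduplicate ℕ._≟_ u)

Equiv : Word → Word → Set
Equiv u v = Σ (length u ≡ length v) λ eq →
  ∀ i j → (lookup u i ≡ lookup u j) ⇔ (lookup v (cast eq i) ≡ lookup v (cast eq j))

ContainsW : Word → Word → Set
ContainsW u f = ∃ λ s → (s ⊆ u) × Equiv s f

-- k-regular: every k consecutive letters are distinct (if |u| < k, the
-- window starting at 0 is the whole word, so all letters are distinct)
Regular : ℕ → Word → Set
Regular k u = ∀ i → Unique (take k (drop i u))

DSAdmissible : ℕ → Word → Word → Set
DSAdmissible n f u = Regular ∥ f ∥ u × ∥ u ∥ ℕ.≤ n × ¬ ContainsW u f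

IsExDS : ℕ → Word → ℕ → Set
IsExDS n f m =
  (Σ Word λ u → DSAdmissible n f u × length u ≡ m)
  × (∀ u → DSAdmissible n f u → length u ℕ.≤ m)

w : ∀ {p k} (F : EOGraph p) → (Fin p → Fin k) → Word
w F comp = map (λ ed → toℕ (comp (proj₁ ed))) (edges F)

w′ : ∀ {p k} (F : EOGraph p) → (Fin p → Fin k) → Word
w′ F comp = concatMap (λ a → replicate (2 * e F) a) (w F comp)

module Submission where

-- Let G be an extremal F-free graph and read its edges in order, writing
-- one endpoint of each edge unless both already occur among the last k − 1
-- letters.  The word u is k-regular on at most n letters, and a charging
-- argument gives e(G) ≤ (k − 1)|u|: a written letter pays for its own edge
-- and for the at most k − 2 pairs it forms with the window, and a skipped
-- edge uses up one such pair.  If u contained w′(F), every edge of F would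
-- yield 2e(F) edges of G through a common hub, the hubs coinciding exactly
-- within components of F and the bundles ordered like the edges of F.
-- Choosing greedily one edge per bundle whose outer end avoids the k hubs
-- and the ends chosen before embeds F in G.  So |u| ≤ ex_DS(n, w′(F)).

open import Defs
open import Data.Nat using (ℕ; _<_; _≤_; _*_; _∸_)
open import Data.Fin using (Fin)

open import Data.Nat as ℕ using (zero; suc; _+_; z≤n; s≤s)
open import Data.Nat.Properties
open import Algebra.Properties.CommutativeSemigroup +-commutativeSemigroup using (x∙yz≈y∙xz)
open import Data.Fin as Fin using (toℕ; fromℕ<; cast; combine)
import Data.Fin.Properties as Fin
open import Data.Product using (∃; ∃₂; _×_; _,_; proj₁; proj₂)
import Data.Product as Product
open import Data.Product.Properties using (,-injectiveˡ; ,-injectiveʳ; ≡-dec)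
open import Data.Sum using (_⊎_; inj₁; inj₂; swap)
open import Data.Empty using (⊥-elim)
open import Data.List using (List; []; _∷_; length; lookup; map; take; filter; _++_; replicate; concatMap; tabulate)
open import Data.List.Properties using (length-filter; length-++; length-map; length-replicate; length-tabulate; length-take; take-take)
open import Data.List.Membership.Propositional using (_∈_; _∉_)
open import Data.List.Membership.Propositional.Properties using (∈-lookup; ∈-tabulate⁺)
open import Data.List.Relation.Unary.Any as Any using (Any; here; there; any?)
open import Data.List.Relation.Unary.Any.Properties using (lookup-index)
open import Data.List.Relation.Unary.All as All using (All; []; _∷_)
import Data.List.Relation.Unary.All.Properties as All
open import Data.List.Relation.Unary.AllPairs using ([]; _∷_)
open import Data.List.Relation.Unary.Unique.Propositional using (Unique)
import Data.List.Relation.Unary.Unique.Propositional.Properties as Unique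
open import Data.List.Relation.Unary.Unique.DecPropositional.Properties using (deduplicate-!)
open import Data.List.Relation.Binary.Sublist.Heterogeneous using (Sublist; []; _∷_; _∷ʳ_)
import Data.List.Relation.Binary.Sublist.Heterogeneous.Properties as Sublist
open import Data.List.Relation.Binary.Sublist.Propositional using (_⊆_; ⊆-refl)
open import Data.List.Relation.Binary.Sublist.Propositional.Properties using (take⁺; filter⁺; length-mono-≤)
open import Relation.Unary using (Decidable)
open import Function.Base using (_∘_)
open import Function.Bundles using (_⇔_; mk⇔; Equivalence)
open import Function.Definitions using (Injective)
open import Relation.Binary.Definitions using (DecidableEquality; tri<; tri≈; tri>)
open import Relation.Binary.PropositionalEquality
open import Relation.Nullary using (¬_; yes; no)
open import Relation.Nullary.Decidable using (¬?; _⊎-dec_)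
open import Relation.Nullary.Negation using (contradiction)

private
  variable
    A B : Set

unique⇒lookup-injective : ∀ {xs : List A} → Unique xs → Injective _≡_ _≡_ (lookup xs)
unique⇒lookup-injective (x∉ ∷ u) {Fin.zero}  {Fin.zero}  _  = refl
unique⇒lookup-injective (x∉ ∷ u) {Fin.zero}  {Fin.suc j} eq = ⊥-elim (All.lookup x∉ (∈-lookup j) eq)
unique⇒lookup-injective (x∉ ∷ u) {Fin.suc i} {Fin.zero}  eq = ⊥-elim (All.lookup x∉ (∈-lookup i) (sym eq))
unique⇒lookup-injective (x∉ ∷ u) {Fin.suc i} {Fin.suc j} eq = cong Fin.suc (unique⇒lookup-injective u eq)

unique⇒length≤ : ∀ {k} {xs : List ℕ} → Unique xs → All (_< k) xs → length xs ≤ k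
unique⇒length≤ {xs = xs} u bounded = Fin.injective⇒≤ {f = f} f-injective
  where
  f : Fin (length xs) → Fin _
  f i = fromℕ< (All.lookup bounded (∈-lookup i))
  f-injective : Injective _≡_ _≡_ f
  f-injective eq = unique⇒lookup-injective u (Fin.fromℕ<-injective _ _ _ _ eq)

all<⇒∥∥≤ : ∀ {k} {u : Word} → All (_< k) u → ∥ u ∥ ≤ k
all<⇒∥∥≤ bounded = unique⇒length≤ (deduplicate-! ℕ._≟_ _) (All.deduplicate⁺ ℕ._≟_ bounded)

<-mono⇒injective : ∀ {a b} {f : Fin a → Fin b} →
  (∀ {i j} → i Fin.< j → f i Fin.< f j) → Injective _≡_ _≡_ f
<-mono⇒injective mono {i} {j} eq with Fin.<-cmp i j
... | tri< i<j _ _ = contradiction eq (Fin.<⇒≢ (mono i<j))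
... | tri≈ _ i≡j _ = i≡j
... | tri> _ _ j<i = contradiction (sym eq) (Fin.<⇒≢ (mono j<i))

record Representatives {m r} (h : Fin m → Fin r → A) (forbidden : List A) : Set where
  field
    choice           : Fin m → Fin r
    choice-injective : Injective _≡_ _≡_ (λ i → h i (choice i))
    choice-∉         : ∀ i → h i (choice i) ∉ forbidden

module _ (_≟_ : DecidableEquality A) where
  open import Data.List.Membership.DecPropositional _≟_ using (_∈?_)

  injective⇒∃∉ : ∀ {r} {f : Fin r → A} → Injective _≡_ _≡_ f →
    (xs : List A) → length xs < r → ∃ λ t → f t ∉ xs
  injective⇒∃∉ {r} {f} f-injective xs xs<r =
    Fin.¬∀⟶∃¬ r (λ t → f t ∈ xs) (λ t → f t ∈? xs) all∈⇒r≤
    where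
    all∈⇒r≤ : ¬ (∀ t → f t ∈ xs)
    all∈⇒r≤ all∈ = <⇒≱ xs<r (Fin.injective⇒≤ {f = Any.index ∘ all∈} position-injective)
      where
      position-injective : Injective _≡_ _≡_ (Any.index ∘ all∈)
      position-injective {t} {t′} eq = f-injective (begin
        f t                               ≡⟨ lookup-index (all∈ t) ⟩
        lookup xs (Any.index (all∈ t))    ≡⟨ cong (lookup xs) eq ⟩
        lookup xs (Any.index (all∈ t′))   ≡⟨ lookup-index (all∈ t′) ⟨
        f t′                              ∎)
        where open ≡-Reasoning

  distinctRepresentatives : ∀ {m r} (h : Fin m → Fin r → A) → (∀ i → Injective _≡_ _≡_ (h i)) →
    (forbidden : List A) → length forbidden + m ≤ r → Representatives h forbidden
  distinctRepresentatives {zero} h h-injective forbidden room =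
    record { choice = λ () ; choice-injective = λ { {()} } ; choice-∉ = λ () }
  distinctRepresentatives {suc m} {r} h h-injective forbidden room =
    record { choice = choice ; choice-injective = choice-injective ; choice-∉ = choice-∉ }
    where
    room′ : suc (length forbidden + m) ≤ r
    room′ = ≤-trans (≤-reflexive (sym (+-suc (length forbidden) m))) room
    first : ∃ λ t → h Fin.zero t ∉ forbidden
    first = injective⇒∃∉ (h-injective Fin.zero) forbidden (≤-trans (s≤s (m≤m+n _ m)) room′)
    rest : Representatives (h ∘ Fin.suc) (h Fin.zero (proj₁ first) ∷ forbidden)
    rest = distinctRepresentatives (h ∘ Fin.suc) (h-injective ∘ Fin.suc) _ room′
    module Rest = Representatives rest
    choice : Fin (suc m) → Fin r
    choice Fin.zero    = proj₁ first
    choice (Fin.suc i) = Rest.choice i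
    choice-∉ : ∀ i → h i (choice i) ∉ forbidden
    choice-∉ Fin.zero    = proj₂ first
    choice-∉ (Fin.suc i) = Rest.choice-∉ i ∘ there
    choice-injective : Injective _≡_ _≡_ (λ i → h i (choice i))
    choice-injective {Fin.zero}  {Fin.zero}  _  = refl
    choice-injective {Fin.zero}  {Fin.suc j} eq = contradiction (here (sym eq)) (Rest.choice-∉ j)
    choice-injective {Fin.suc i} {Fin.zero}  eq = contradiction (here eq) (Rest.choice-∉ i)
    choice-injective {Fin.suc i} {Fin.suc j} eq = cong Fin.suc (Rest.choice-injective eq)

Unique-take-≤ : ∀ {i k} {xs : List A} → i ≤ k → Unique (take k xs) → Unique (take i xs)
Unique-take-≤ {i = i} {k} {xs} i≤k u =
  subst Unique (trans (take-take i k xs) (cong (λ l → take l xs) (m≤n⇒m⊓n≡m i≤k))) (Unique.take⁺ i u)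

Regular-≤ : ∀ {i k} {u : Word} → i ≤ k → Regular k u → Regular i u
Regular-≤ i≤k reg i = Unique-take-≤ i≤k (reg i)

Regular-∷ : ∀ {j x} {u : Word} → x ∉ take j u → Regular (suc j) u → Regular (suc j) (x ∷ u)
Regular-∷ {j} x∉ reg zero    = All.¬Any⇒All¬ _ x∉ ∷ Unique-take-≤ (n≤1+n j) (reg 0)
Regular-∷     x∉ reg (suc i) = reg i

nth : A → List A → ℕ → A
nth d []       _       = d
nth d (x ∷ xs) zero    = x
nth d (x ∷ xs) (suc q) = nth d xs q

lookup≡nth : ∀ (d : A) xs (i : Fin (length xs)) → lookup xs i ≡ nth d xs (toℕ i)
lookup≡nth d (x ∷ xs) Fin.zero    = refl
lookup≡nth d (x ∷ xs) (Fin.suc i) = lookup≡nth d xs i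

nth-map : ∀ (d : B) (g : A → B) xs (i : Fin (length xs)) → nth d (map g xs) (toℕ i) ≡ g (lookup xs i)
nth-map d g (x ∷ xs) Fin.zero    = refl
nth-map d g (x ∷ xs) (Fin.suc i) = nth-map d g xs i

nth-++ʳ : ∀ (d : A) xs ys q → nth d (xs ++ ys) (length xs + q) ≡ nth d ys q
nth-++ʳ d []       ys q = refl
nth-++ʳ d (x ∷ xs) ys q = nth-++ʳ d xs ys q

nth-replicate-++ : ∀ (d x : A) {r} ys {t} → t < r → nth d (replicate r x ++ ys) t ≡ x
nth-replicate-++ d x {suc r} ys {zero}  _         = refl
nth-replicate-++ d x {suc r} ys {suc t} (s≤s t<r) = nth-replicate-++ d x ys t<r

nth-concatMap-replicate : ∀ {A : Set} (d : A) r xs {i t} → i < length xs → t < r →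
  nth d (concatMap (replicate r) xs) (i * r + t) ≡ nth d xs i
nth-concatMap-replicate d r (x ∷ xs) {zero}  _         t<r = nth-replicate-++ d x _ t<r
nth-concatMap-replicate {A} d r (x ∷ xs) {suc i} {t} (s≤s i<l) t<r = begin
  nth d (replicate r x ++ rest) (suc i * r + t)         ≡⟨ cong (nth d (replicate r x ++ rest)) position ⟩
  nth d (replicate r x ++ rest) (length (replicate r x) + (i * r + t))
                                                        ≡⟨ nth-++ʳ d (replicate r x) rest (i * r + t) ⟩
  nth d rest (i * r + t)                                 ≡⟨ nth-concatMap-replicate d r xs i<l t<r ⟩
  nth d xs i                                             ∎
  where
  open ≡-Reasoning
  rest : List A
  rest = concatMap (replicate r) xs
  position : suc i * r + t ≡ length (replicate r x) + (i * r + t)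
  position = trans (+-assoc r (i * r) t) (cong (_+ (i * r + t)) (sym (length-replicate r)))

length-concatMap-replicate : ∀ r (xs : List A) → length (concatMap (replicate r) xs) ≡ length xs * r
length-concatMap-replicate r []       = refl
length-concatMap-replicate r (x ∷ xs) =
  trans (length-++ (replicate r x)) (cong₂ _+_ (length-replicate r) (length-concatMap-replicate r xs))

record IndexEmbedding {A B : Set} (R : A → B → Set) (xs : List A) (ys : List B) : Set where
  field
    index     : Fin (length xs) → Fin (length ys)
    index-<   : ∀ {i j} → i Fin.< j → index i Fin.< index j
    index-rel : ∀ i → R (lookup xs i) (lookup ys (index i))

Sublist⇒IndexEmbedding : ∀ {R : A → B → Set} {xs ys} → Sublist R xs ys → IndexEmbedding R xs ys
Sublist⇒IndexEmbedding [] = record { index = λ () ; index-< = λ { {()} } ; index-rel = λ () }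
Sublist⇒IndexEmbedding (y ∷ʳ sub) = record
  { index = Fin.suc ∘ index ; index-< = s≤s ∘ index-< ; index-rel = index-rel }
  where open IndexEmbedding (Sublist⇒IndexEmbedding sub)
Sublist⇒IndexEmbedding {R = R} {x ∷ xs} {y ∷ ys} (rxy ∷ sub) = record
  { index = index′ ; index-< = index′-< ; index-rel = index′-rel }
  where
  open IndexEmbedding (Sublist⇒IndexEmbedding sub)
  index′ : Fin (suc (length xs)) → Fin (suc (length ys))
  index′ Fin.zero    = Fin.zero
  index′ (Fin.suc i) = Fin.suc (index i)
  index′-< : ∀ {i j} → i Fin.< j → index′ i Fin.< index′ j
  index′-< {Fin.zero}  {Fin.suc j} _         = s≤s z≤n
  index′-< {Fin.suc i} {Fin.suc j} (s≤s i<j) = s≤s (index-< i<j)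
  index′-rel : ∀ i → R (lookup (x ∷ xs) i) (lookup (y ∷ ys) (index′ i))
  index′-rel Fin.zero    = rxy
  index′-rel (Fin.suc i) = index-rel i

Joins : A × A → A → A → Set
Joins uv x y = uv ≡ (x , y) ⊎ uv ≡ (y , x)

Joins-sym : ∀ {uv} {x y : A} → Joins uv x y → Joins uv y x
Joins-sym = swap

Joins-map : ∀ (f : A → B) {uv x y E} → Joins uv x y → Joins E (f x) (f y) → Joins E (f (proj₁ uv)) (f (proj₂ uv))
Joins-map f (inj₁ refl) j = j
Joins-map f (inj₂ refl) j = Joins-sym j

Joins-endpoint : ∀ {uv} {x y a b : A} → Joins uv x y → Joins uv a b → a ≡ x ⊎ a ≡ y
Joins-endpoint (inj₁ refl) (inj₁ eq) = inj₁ (sym (,-injectiveˡ eq))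
Joins-endpoint (inj₁ refl) (inj₂ eq) = inj₂ (sym (,-injectiveʳ eq))
Joins-endpoint (inj₂ refl) (inj₁ eq) = inj₂ (sym (,-injectiveˡ eq))
Joins-endpoint (inj₂ refl) (inj₂ eq) = inj₁ (sym (,-injectiveʳ eq))

Simple : ∀ {n} → Fin n × Fin n → Set
Simple uv = proj₁ uv Fin.< proj₂ uv

Joins-irrefl : ∀ {n} {uv} {x : Fin n} → Simple uv → ¬ Joins uv x x
Joins-irrefl s (inj₁ refl) = Fin.<-irrefl refl s
Joins-irrefl s (inj₂ refl) = Fin.<-irrefl refl s

Joins-unique : ∀ {n} {uv uv′} {x y : Fin n} → Simple uv → Simple uv′ → Joins uv x y → Joins uv′ x y → uv ≡ uv′
Joins-unique s s′ (inj₁ refl) (inj₁ refl) = refl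
Joins-unique s s′ (inj₁ refl) (inj₂ refl) = ⊥-elim (Fin.<-asym s s′)
Joins-unique s s′ (inj₂ refl) (inj₁ refl) = ⊥-elim (Fin.<-asym s s′)
Joins-unique s s′ (inj₂ refl) (inj₂ refl) = refl

labels : ∀ {n} → Fin n × Fin n → ℕ × ℕ
labels = Product.map toℕ toℕ

Joins-labels⁻ : ∀ {n} {uv} {x y : Fin n} → Joins (labels uv) (toℕ x) (toℕ y) → Joins uv x y
Joins-labels⁻ (inj₁ eq) = inj₁ (cong₂ _,_ (Fin.toℕ-injective (,-injectiveˡ eq)) (Fin.toℕ-injective (,-injectiveʳ eq)))
Joins-labels⁻ (inj₂ eq) = inj₂ (cong₂ _,_ (Fin.toℕ-injective (,-injectiveˡ eq)) (Fin.toℕ-injective (,-injectiveʳ eq)))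

Incident : ∀ {n} → ℕ → Fin n × Fin n → Set
Incident x uv = toℕ (proj₁ uv) ≡ x ⊎ toℕ (proj₂ uv) ≡ x

endpoint : ∀ {n x} {uv : Fin n × Fin n} → Incident x uv → Fin n
endpoint {uv = uv} (inj₁ _) = proj₁ uv
endpoint {uv = uv} (inj₂ _) = proj₂ uv

toℕ-endpoint : ∀ {n x} {uv : Fin n × Fin n} (p : Incident x uv) → toℕ (endpoint p) ≡ x
toℕ-endpoint (inj₁ eq) = eq
toℕ-endpoint (inj₂ eq) = eq

endpoint-joins : ∀ {n x} {uv : Fin n × Fin n} (p : Incident x uv) → ∃ (Joins uv (endpoint p))
endpoint-joins {uv = uv} (inj₁ _) = proj₂ uv , inj₁ refl
endpoint-joins {uv = uv} (inj₂ _) = proj₁ uv , inj₂ refl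

-- Counting unjoined pairs of letters

filter-length-≤ : ∀ {P Q : A → Set} (P? : Decidable P) (Q? : Decidable Q) → (∀ {x} → P x → Q x) →
  ∀ xs → length (filter P? xs) ≤ length (filter Q? xs)
filter-length-≤ P? Q? P⇒Q xs = length-mono-≤ (filter⁺ P? Q? (λ { refl → P⇒Q }) (⊆-refl {x = xs}))

filter-length-< : ∀ {P Q : A → Set} (P? : Decidable P) (Q? : Decidable Q) → (∀ {x} → P x → Q x) →
  ∀ {y xs} → y ∈ xs → Q y → ¬ P y → length (filter P? xs) < length (filter Q? xs)
filter-length-< P? Q? P⇒Q {xs = x ∷ xs} (here refl) qy ¬py with P? x | Q? x
... | yes px | _      = contradiction px ¬py
... | no _   | yes _  = s≤s (filter-length-≤ P? Q? P⇒Q xs)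
... | no _   | no ¬qy = contradiction qy ¬qy
filter-length-< P? Q? P⇒Q {xs = x ∷ xs} (there y∈) qy ¬py with P? x | Q? x
... | yes _  | yes _  = s≤s (filter-length-< P? Q? P⇒Q y∈ qy ¬py)
... | yes px | no ¬qx = contradiction (P⇒Q px) ¬qx
... | no _   | yes _  = m≤n⇒m≤1+n (filter-length-< P? Q? P⇒Q y∈ qy ¬py)
... | no _   | no _   = filter-length-< P? Q? P⇒Q y∈ qy ¬py

module _ {n : ℕ} where

  Unjoined : List (Fin n × Fin n) → ℕ → ℕ → Set
  Unjoined R a b = ¬ Any (λ uv → Joins (labels uv) a b) R

  unjoined? : ∀ R a → Decidable (Unjoined R a)
  unjoined? R a b = ¬? (any? (λ uv → ≡-dec ℕ._≟_ ℕ._≟_ (labels uv) (a , b) ⊎-dec ≡-dec ℕ._≟_ ℕ._≟_ (labels uv) (b , a)) R)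

  unjoinedWith : List (Fin n × Fin n) → ℕ → Word → ℕ
  unjoinedWith R a V = length (filter (unjoined? R a) V)

  unjoinedPairs : List (Fin n × Fin n) → Word → ℕ
  unjoinedPairs R []      = 0
  unjoinedPairs R (a ∷ V) = unjoinedWith R a V + unjoinedPairs R V

  unjoinedPairs-mono : ∀ {R R′ V V′} → (∀ {a b} → Unjoined R′ a b → Unjoined R a b) → V ⊆ V′ →
    unjoinedPairs R′ V ≤ unjoinedPairs R V′
  unjoinedPairs-mono R′⇒R [] = z≤n
  unjoinedPairs-mono {R} {V′ = y ∷ V′} R′⇒R (y ∷ʳ V⊆V′) = ≤-trans (unjoinedPairs-mono R′⇒R V⊆V′) (m≤n+m _ (unjoinedWith R y V′))
  unjoinedPairs-mono {R} {R′} {a ∷ V} R′⇒R (refl ∷ V⊆V′) =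
    +-mono-≤ (length-mono-≤ (filter⁺ (unjoined? R′ a) (unjoined? R a) (λ { refl → R′⇒R }) V⊆V′)) (unjoinedPairs-mono R′⇒R V⊆V′)

  unjoinedPairs-∷-≤ : ∀ uv R V → unjoinedPairs (uv ∷ R) V ≤ unjoinedPairs R V
  unjoinedPairs-∷-≤ uv R V = unjoinedPairs-mono {R} {uv ∷ R} (_∘ there) (⊆-refl {x = V})

  unjoinedWith-< : ∀ {uv R a b V} → Unjoined R a b → Joins (labels uv) a b → b ∈ V →
    unjoinedWith (uv ∷ R) a V < unjoinedWith R a V
  unjoinedWith-< {uv} {R} {a} unjoined joins b∈V =
    filter-length-< (unjoined? (uv ∷ R) a) (unjoined? R a) (_∘ there) b∈V unjoined (λ u → u (here joins))

  unjoinedPairs-< : ∀ {uv R a b V} → a ≢ b → Unjoined R a b → Joins (labels uv) a b → a ∈ V → b ∈ V →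
    unjoinedPairs (uv ∷ R) V < unjoinedPairs R V
  unjoinedPairs-< a≢b _ _ (here refl) (here refl) = contradiction refl a≢b
  unjoinedPairs-< {uv} {R} {V = _ ∷ V} a≢b unjoined joins (here refl) (there b∈V) =
    +-mono-<-≤ (unjoinedWith-< unjoined joins b∈V) (unjoinedPairs-∷-≤ uv R V)
  unjoinedPairs-< {uv} {R} {V = _ ∷ V} a≢b unjoined joins (there a∈V) (here refl) =
    +-mono-<-≤ (unjoinedWith-< (unjoined ∘ Any.map Joins-sym) (Joins-sym joins) a∈V) (unjoinedPairs-∷-≤ uv R V)
  unjoinedPairs-< {uv} {R} {V = c ∷ V} a≢b unjoined joins (there a∈V) (there b∈V) =
    +-mono-≤-< (filter-length-≤ (unjoined? (uv ∷ R) c) (unjoined? R c) (_∘ there) V)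
               (unjoinedPairs-< a≢b unjoined joins a∈V b∈V)

  fresh⇒unjoined : ∀ {a b : Fin n} {R} → Simple (a , b) → All Simple R → All ((a , b) ≢_) R →
    Unjoined R (toℕ a) (toℕ b)
  fresh⇒unjoined s (s′ ∷ ss) (new ∷ news) (here joins) = new (Joins-unique s s′ (inj₁ refl) (Joins-labels⁻ joins))
  fresh⇒unjoined s (s′ ∷ ss) (new ∷ news) (there p)    = fresh⇒unjoined s ss news p

-- The greedy word of an edge list

-- Edges are processed from the last one down and letters are written at
-- the front, so `take (suc j)` is the window of the last suc j letters.
module GreedyWord {n : ℕ} (j : ℕ) where
  open import Data.List.Membership.DecPropositional ℕ._≟_ using (_∈?_)

  window : Word → Word
  window = take (suc j)

  extend : ℕ → ℕ → Word → Word
  extend x y u with x ∈? window u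
  ... | no _ = x ∷ u
  ... | yes _ with y ∈? window u
  ...   | no _  = y ∷ u
  ...   | yes _ = u

  data Extension (x y : ℕ) (u : Word) : Word → Set where
    write₁ : x ∉ window u → Extension x y u (x ∷ u)
    write₂ : x ∈ window u → y ∉ window u → Extension x y u (y ∷ u)
    skip   : x ∈ window u → y ∈ window u → Extension x y u u

  extension : ∀ x y u → Extension x y u (extend x y u)
  extension x y u with x ∈? window u
  ... | no x∉ = write₁ x∉
  ... | yes x∈ with y ∈? window u
  ...   | no y∉  = write₂ x∈ y∉
  ...   | yes y∈ = skip x∈ y∈

  greedyWord : List (Fin n × Fin n) → Word
  greedyWord []             = []
  greedyWord ((a , b) ∷ R) = extend (toℕ a) (toℕ b) (greedyWord R)

  greedyWord-⊆ : ∀ R → Sublist Incident (greedyWord R) R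
  greedyWord-⊆ [] = []
  greedyWord-⊆ ((a , b) ∷ R) with extend (toℕ a) (toℕ b) (greedyWord R) | extension (toℕ a) (toℕ b) (greedyWord R)
  ... | _ | write₁ _   = inj₁ refl ∷ greedyWord-⊆ R
  ... | _ | write₂ _ _ = inj₂ refl ∷ greedyWord-⊆ R
  ... | _ | skip _ _   = (a , b) ∷ʳ greedyWord-⊆ R

  greedyWord-< : ∀ R → All (_< n) (greedyWord R)
  greedyWord-< [] = []
  greedyWord-< ((a , b) ∷ R) with extend (toℕ a) (toℕ b) (greedyWord R) | extension (toℕ a) (toℕ b) (greedyWord R)
  ... | _ | write₁ _   = Fin.toℕ<n a ∷ greedyWord-< R
  ... | _ | write₂ _ _ = Fin.toℕ<n b ∷ greedyWord-< R
  ... | _ | skip _ _   = greedyWord-< R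

  greedyWord-regular : ∀ R → Regular (suc (suc j)) (greedyWord R)
  greedyWord-regular [] zero    = []
  greedyWord-regular [] (suc i) = []
  greedyWord-regular ((a , b) ∷ R) with extend (toℕ a) (toℕ b) (greedyWord R) | extension (toℕ a) (toℕ b) (greedyWord R)
  ... | _ | write₁ a∉   = Regular-∷ a∉ (greedyWord-regular R)
  ... | _ | write₂ _ b∉ = Regular-∷ b∉ (greedyWord-regular R)
  ... | _ | skip _ _    = greedyWord-regular R

  length+unjoined≤-write : ∀ (uv : Fin n × Fin n) R u x → length R + unjoinedPairs R (window u) ≤ suc j * length u →
    suc (length R) + unjoinedPairs (uv ∷ R) (window (x ∷ u)) ≤ suc j * length (x ∷ u)
  length+unjoined≤-write uv R u x invariant = begin
    suc (length R) + (unjoinedWith (uv ∷ R) x (take j u) + unjoinedPairs (uv ∷ R) (take j u))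
      ≤⟨ +-monoʳ-≤ (suc (length R)) (+-mono-≤ new-pairs old-pairs) ⟩
    suc (length R) + (j + unjoinedPairs R (window u))
      ≡⟨ cong suc (x∙yz≈y∙xz (length R) j _) ⟩
    suc j + (length R + unjoinedPairs R (window u))
      ≤⟨ +-monoʳ-≤ (suc j) invariant ⟩
    suc j + suc j * length u
      ≡⟨ *-suc (suc j) (length u) ⟨
    suc j * suc (length u) ∎
    where
    open ≤-Reasoning
    new-pairs : unjoinedWith (uv ∷ R) x (take j u) ≤ j
    new-pairs = ≤-trans (length-filter _ (take j u)) (≤-trans (≤-reflexive (length-take j u)) (m⊓n≤m j _))
    old-pairs : unjoinedPairs (uv ∷ R) (take j u) ≤ unjoinedPairs R (window u)
    old-pairs = unjoinedPairs-mono {R = R} {R′ = uv ∷ R} (_∘ there) (take⁺ {xs = u} (n≤1+n j))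

  length+unjoined≤ : ∀ R → All Simple R → Unique R →
    length R + unjoinedPairs R (window (greedyWord R)) ≤ suc j * length (greedyWord R)
  length+unjoined≤ [] _ _ = z≤n
  length+unjoined≤ ((a , b) ∷ R) (s ∷ ss) (new ∷ distinct) with extend (toℕ a) (toℕ b) (greedyWord R) | extension (toℕ a) (toℕ b) (greedyWord R)
  ... | _ | write₁ _   = length+unjoined≤-write (a , b) R (greedyWord R) (toℕ a) (length+unjoined≤ R ss distinct)
  ... | _ | write₂ _ _ = length+unjoined≤-write (a , b) R (greedyWord R) (toℕ b) (length+unjoined≤ R ss distinct)
  ... | _ | skip a∈ b∈ = ≤-trans (+-monoʳ-< (length R) fewer) (length+unjoined≤ R ss distinct)
    where
    a≢b : toℕ a ≢ toℕ b
    a≢b eq = Fin.<-irrefl (Fin.toℕ-injective eq) s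
    fewer : unjoinedPairs ((a , b) ∷ R) (window (greedyWord R)) < unjoinedPairs R (window (greedyWord R))
    fewer = unjoinedPairs-< a≢b (fresh⇒unjoined s ss new) (inj₁ refl) a∈ b∈

  length≤greedyWord : ∀ R → All Simple R → Unique R → length R ≤ suc j * length (greedyWord R)
  length≤greedyWord R ss distinct = ≤-trans (m≤m+n (length R) _) (length+unjoined≤ R ss distinct)

edgeComp : ∀ {p k} (F : EOGraph p) → (Fin p → Fin k) → Fin (e F) → Fin k
edgeComp F comp i = comp (proj₁ (lookup (edges F) i))

module StarForestProperties {p k} {F : EOGraph p} {comp : Fin p → Fin k} (SF : StarForest F k comp) where
  open StarForest SF

  centre : Fin k → Fin p
  centre c = proj₁ (center c)

  comp-centre : ∀ c → comp (centre c) ≡ c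
  comp-centre c = proj₁ (proj₂ (center c))

  comp-on-edge : ∀ {i x y} → Joins (lookup (edges F) i) x y → comp x ≡ edgeComp F comp i
  comp-on-edge {i} joins with Joins-endpoint (inj₁ refl) joins
  ... | inj₁ refl = refl
  ... | inj₂ refl = sym (sameComp (∈-lookup i))

  vertex-on-edge : ∀ x → ∃₂ λ i y → Joins (lookup (edges F) i) x y
  vertex-on-edge x with noIsolated x
  ... | y , inj₁ xy∈ = Any.index xy∈ , y , inj₁ (sym (lookup-index xy∈))
  ... | y , inj₂ yx∈ = Any.index yx∈ , y , inj₂ (sym (lookup-index yx∈))

  componentEdge : ∀ c → ∃ λ i → edgeComp F comp i ≡ c
  componentEdge c with surj c
  ... | x , refl with vertex-on-edge x
  ...   | i , _ , joins = i , sym (comp-on-edge joins)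

  k≤e : k ≤ e F
  k≤e = Fin.injective⇒≤ {f = proj₁ ∘ componentEdge} λ {c} {c′} eq →
    trans (sym (proj₂ (componentEdge c))) (trans (cong (edgeComp F comp) eq) (proj₂ (componentEdge c′)))

  edge-simple : ∀ i → Simple (lookup (edges F) i)
  edge-simple i = All.lookup (simple F) (∈-lookup i)

  petalJoins : ∀ i → ∃ (Joins (lookup (edges F) i) (centre (edgeComp F comp i)))
  petalJoins i with proj₂ (proj₂ (center (edgeComp F comp i))) (∈-lookup i) refl
  ... | inj₁ src≡ = proj₂ (lookup (edges F) i) , inj₁ (cong (_, _) src≡)
  ... | inj₂ tgt≡ = proj₁ (lookup (edges F) i) , inj₂ (cong (_ ,_) tgt≡)

  petal : Fin (e F) → Fin p
  petal i = proj₁ (petalJoins i)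

  edge-joins : ∀ i → Joins (lookup (edges F) i) (centre (edgeComp F comp i)) (petal i)
  edge-joins i = proj₂ (petalJoins i)

  comp-petal : ∀ i → comp (petal i) ≡ edgeComp F comp i
  comp-petal i = comp-on-edge (Joins-sym (edge-joins i))

  petal≢centre : ∀ i c → petal i ≢ centre c
  petal≢centre i c eq = Joins-irrefl (edge-simple i) (subst (Joins _ _) (trans eq (cong centre same)) (edge-joins i))
    where
    same : c ≡ edgeComp F comp i
    same = trans (sym (comp-centre c)) (trans (cong comp (sym eq)) (comp-petal i))

  petal-injective : Injective _≡_ _≡_ petal
  petal-injective {i} {i′} eq = unique⇒lookup-injective (distinct F)
    (Joins-unique (edge-simple i) (edge-simple i′) (edge-joins i) joins′)
    where
    same : edgeComp F comp i′ ≡ edgeComp F comp i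
    same = trans (sym (comp-petal i′)) (trans (cong comp (sym eq)) (comp-petal i))
    joins′ : Joins (lookup (edges F) i′) (centre (edgeComp F comp i)) (petal i)
    joins′ = subst₂ (Joins _) (cong centre same) (sym eq) (edge-joins i′)

  centre-or-petal : ∀ x → x ≡ centre (comp x) ⊎ ∃ λ i → x ≡ petal i
  centre-or-petal x with vertex-on-edge x
  ... | i , _ , joins with Joins-endpoint (edge-joins i) joins
  ...   | inj₁ x≡centre = inj₁ (trans x≡centre (cong centre (sym (comp-on-edge joins))))
  ...   | inj₂ x≡petal  = inj₂ (i , x≡petal)

-- What a copy of w′(F) leaves in G: for the i-th edge of F a bundle of r
-- edges of G through a hub, hubs shared exactly within a component of F,
-- and the bundles ordered like the edges of F.
record Spokes {p k n} (F : EOGraph p) (comp : Fin p → Fin k) (G : EOGraph n) (r : ℕ) : Set where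
  field
    hub             : Fin (e F) → Fin n
    hub-≡           : ∀ i i′ → hub i ≡ hub i′ ⇔ edgeComp F comp i ≡ edgeComp F comp i′
    spoke           : Fin (e F) → Fin r → Fin (e G)
    spoke-injective : ∀ i → Injective _≡_ _≡_ (spoke i)
    spoke-<         : ∀ {i i′} t t′ → i Fin.< i′ → spoke i t Fin.< spoke i′ t′
    spoke-hub       : ∀ i t → ∃ (Joins (lookup (edges G) (spoke i t)) (hub i))

module SpokesEmbedding {p k n r} {F : EOGraph p} {comp : Fin p → Fin k} {G : EOGraph n}
  (SF : StarForest F k comp) (S : Spokes F comp G r) (room : k + e F ≤ r) where
  open StarForestProperties SF
  open Spokes S

  hubOf : Fin k → Fin n
  hubOf c = hub (proj₁ (componentEdge c))

  hub≡hubOf : ∀ i → hub i ≡ hubOf (edgeComp F comp i)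
  hub≡hubOf i = Equivalence.from (hub-≡ i _) (sym (proj₂ (componentEdge (edgeComp F comp i))))

  hubOf-injective : Injective _≡_ _≡_ hubOf
  hubOf-injective {c} {c′} eq =
    trans (sym (proj₂ (componentEdge c))) (trans (Equivalence.to (hub-≡ _ _) eq) (proj₂ (componentEdge c′)))

  rim : Fin (e F) → Fin r → Fin n
  rim i t = proj₁ (spoke-hub i t)

  rim-injective : ∀ i → Injective _≡_ _≡_ (rim i)
  rim-injective i {t} {t′} eq = spoke-injective i (unique⇒lookup-injective (distinct G)
    (Joins-unique (simple-at (spoke i t)) (simple-at (spoke i t′))
      (proj₂ (spoke-hub i t)) (subst (Joins _ (hub i)) (sym eq) (proj₂ (spoke-hub i t′)))))
    where
    simple-at : ∀ l → Simple (lookup (edges G) l)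
    simple-at l = All.lookup (simple G) (∈-lookup l)

  hubs : List (Fin n)
  hubs = tabulate hubOf

  leaves : Representatives rim hubs
  leaves = distinctRepresentatives Fin._≟_ rim rim-injective hubs
             (subst (λ l → l + e F ≤ r) (sym (length-tabulate hubOf)) room)

  open Representatives leaves renaming (choice to chosen; choice-injective to leaf-injective)

  leaf : Fin (e F) → Fin n
  leaf i = rim i (chosen i)

  leaf≢hubOf : ∀ i c → leaf i ≢ hubOf c
  leaf≢hubOf i c eq = choice-∉ i (subst (_∈ hubs) (sym eq) (∈-tabulate⁺ c))

  φ : Fin p → Fin n
  φ x with centre-or-petal x
  ... | inj₁ _       = hubOf (comp x)
  ... | inj₂ (i , _) = leaf i

  φ-centre : ∀ c → φ (centre c) ≡ hubOf c
  φ-centre c with centre-or-petal (centre c)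
  ... | inj₁ _       = cong hubOf (comp-centre c)
  ... | inj₂ (i , eq) = contradiction (sym eq) (petal≢centre i c)

  φ-petal : ∀ i → φ (petal i) ≡ leaf i
  φ-petal i with centre-or-petal (petal i)
  ... | inj₁ eq        = contradiction eq (petal≢centre i _)
  ... | inj₂ (i′ , eq) = cong leaf (sym (petal-injective eq))

  φ-injective : Injective _≡_ _≡_ φ
  φ-injective {x} {y} eq = cases (centre-or-petal x) (centre-or-petal y)
    where
    φ-centre′ : ∀ {z} → z ≡ centre (comp z) → φ z ≡ hubOf (comp z)
    φ-centre′ z≡ = trans (cong φ z≡) (φ-centre _)
    φ-petal′ : ∀ {z i} → z ≡ petal i → φ z ≡ leaf i
    φ-petal′ {i = i} z≡ = trans (cong φ z≡) (φ-petal i)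
    cases : x ≡ centre (comp x) ⊎ ∃ (λ i → x ≡ petal i) → y ≡ centre (comp y) ⊎ ∃ (λ i → y ≡ petal i) → x ≡ y
    cases (inj₁ x≡) (inj₁ y≡) =
      trans x≡ (trans (cong centre (hubOf-injective (trans (sym (φ-centre′ x≡)) (trans eq (φ-centre′ y≡))))) (sym y≡))
    cases (inj₁ x≡) (inj₂ (i , y≡)) = ⊥-elim (leaf≢hubOf i (comp x) (trans (sym (φ-petal′ y≡)) (trans (sym eq) (φ-centre′ x≡))))
    cases (inj₂ (i , x≡)) (inj₁ y≡) = ⊥-elim (leaf≢hubOf i (comp y) (trans (sym (φ-petal′ x≡)) (trans eq (φ-centre′ y≡))))
    cases (inj₂ (i , x≡)) (inj₂ (i′ , y≡)) =
      trans x≡ (trans (cong petal (leaf-injective (trans (sym (φ-petal′ x≡)) (trans eq (φ-petal′ y≡))))) (sym y≡))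

  ψ : Fin (e F) → Fin (e G)
  ψ i = spoke i (chosen i)

  ψ-hit : ∀ i → Joins (lookup (edges G) (ψ i)) (φ (proj₁ (lookup (edges F) i))) (φ (proj₂ (lookup (edges F) i)))
  ψ-hit i = Joins-map φ (edge-joins i) (subst₂ (Joins _) hub≡ (sym (φ-petal i)) (proj₂ (spoke-hub i (chosen i))))
    where
    hub≡ : hub i ≡ φ (centre (edgeComp F comp i))
    hub≡ = trans (hub≡hubOf i) (sym (φ-centre _))

  embedding : Embedding F G
  embedding = record
    { φ = φ ; φ-inj = φ-injective ; ψ = ψ ; ψ-mono = λ _ _ → spoke-< _ _ ; ψ-hit = ψ-hit }

module CopyOfW′ {p k n} (F : EOGraph p) (comp : Fin p → Fin k) (G : EOGraph n) {s : Word}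
  (s⊆ : Sublist Incident s (edges G)) (s≈w′ : Equiv s (w′ F comp)) where
  open IndexEmbedding (Sublist⇒IndexEmbedding s⊆)

  r : ℕ
  r = 2 * e F

  length-s : length s ≡ e F * r
  length-s = trans (proj₁ s≈w′) (trans (length-concatMap-replicate r (w F comp)) (cong (_* r) (length-map _ (edges F))))

  position : Fin (e F) → Fin r → Fin (length s)
  position i t = cast (sym length-s) (combine i t)

  toℕ-position : ∀ i t → toℕ (position i t) ≡ toℕ (combine i t)
  toℕ-position i t = Fin.toℕ-cast (sym length-s) (combine i t)

  position-<ˡ : ∀ {i i′} t t′ → i Fin.< i′ → position i t Fin.< position i′ t′
  position-<ˡ t t′ i<i′ = subst₂ ℕ._<_ (sym (toℕ-position _ t)) (sym (toℕ-position _ t′)) (Fin.combine-monoˡ-< t t′ i<i′)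

  position-injectiveʳ : ∀ i → Injective _≡_ _≡_ (position i)
  position-injectiveʳ i {t} {t′} eq = Fin.combine-injectiveʳ i t i t′
    (Fin.toℕ-injective (trans (sym (toℕ-position i t)) (trans (cong toℕ eq) (toℕ-position i t′))))

  w′-at : ∀ i t → lookup (w′ F comp) (cast (proj₁ s≈w′) (position i t)) ≡ toℕ (edgeComp F comp i)
  w′-at i t = begin
    lookup (w′ F comp) (cast (proj₁ s≈w′) (position i t))    ≡⟨ lookup≡nth 0 (w′ F comp) _ ⟩
    nth 0 (w′ F comp) (toℕ (cast (proj₁ s≈w′) (position i t))) ≡⟨ cong (nth 0 (w′ F comp)) offset ⟩
    nth 0 (w′ F comp) (toℕ i * r + toℕ t)                     ≡⟨ nth-concatMap-replicate 0 r (w F comp) i<length (Fin.toℕ<n t) ⟩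
    nth 0 (w F comp) (toℕ i)                                  ≡⟨ nth-map 0 (λ uv → toℕ (comp (proj₁ uv))) (edges F) i ⟩
    toℕ (edgeComp F comp i)                                   ∎
    where
    open ≡-Reasoning
    offset : toℕ (cast (proj₁ s≈w′) (position i t)) ≡ toℕ i * r + toℕ t
    offset = trans (Fin.toℕ-cast _ _) (trans (toℕ-position i t) (trans (Fin.toℕ-combine i t) (cong (_+ toℕ t) (*-comm r (toℕ i)))))
    i<length : toℕ i < length (w F comp)
    i<length = subst (toℕ i <_) (sym (length-map _ (edges F))) (Fin.toℕ<n i)

  letter : Fin (e F) → Fin r → ℕ
  letter i t = lookup s (position i t)

  letter-≡ : ∀ i t i′ t′ → letter i t ≡ letter i′ t′ ⇔ edgeComp F comp i ≡ edgeComp F comp i′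
  letter-≡ i t i′ t′ = mk⇔
    (λ eq → Fin.toℕ-injective (trans (sym (w′-at i t)) (trans (Equivalence.to (proj₂ s≈w′ _ _) eq) (w′-at i′ t′))))
    (λ eq → Equivalence.from (proj₂ s≈w′ _ _) (trans (w′-at i t) (trans (cong toℕ eq) (sym (w′-at i′ t′)))))

  spoke : Fin (e F) → Fin r → Fin (e G)
  spoke i t = index (position i t)

  incident : ∀ i t → Incident (letter i t) (lookup (edges G) (spoke i t))
  incident i t = index-rel (position i t)

  -- Any spoke determines the hub; as r = e F + (e F + 0), i itself is a spoke number.
  first : Fin (e F) → Fin r
  first i = Fin.inject≤ i (m≤m+n (e F) _)

  hub : Fin (e F) → Fin n
  hub i = endpoint (incident i (first i))

  toℕ-hub : ∀ i t → toℕ (hub i) ≡ letter i t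
  toℕ-hub i t = trans (toℕ-endpoint (incident i (first i))) (Equivalence.from (letter-≡ i (first i) i t) refl)

  hub-≡ : ∀ i i′ → hub i ≡ hub i′ ⇔ edgeComp F comp i ≡ edgeComp F comp i′
  hub-≡ i i′ = mk⇔
    (λ eq → Equivalence.to (letter-≡ i (first i) i′ (first i′))
              (trans (sym (toℕ-hub i (first i))) (trans (cong toℕ eq) (toℕ-hub i′ (first i′)))))
    (λ eq → Fin.toℕ-injective (trans (toℕ-hub i (first i))
              (trans (Equivalence.from (letter-≡ i (first i) i′ (first i′)) eq) (sym (toℕ-hub i′ (first i′))))))

  spoke-hub : ∀ i t → ∃ (Joins (lookup (edges G) (spoke i t)) (hub i))
  spoke-hub i t = subst (λ v → ∃ (Joins (lookup (edges G) (spoke i t)) v)) endpoint≡hub (endpoint-joins (incident i t))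
    where
    endpoint≡hub : endpoint (incident i t) ≡ hub i
    endpoint≡hub = Fin.toℕ-injective (trans (toℕ-endpoint (incident i t)) (sym (toℕ-hub i t)))

  spokes : Spokes F comp G r
  spokes = record
    { hub = hub
    ; hub-≡ = hub-≡
    ; spoke = spoke
    ; spoke-injective = λ i → position-injectiveʳ i ∘ <-mono⇒injective index-<
    ; spoke-< = λ t t′ i<i′ → index-< (position-<ˡ t t′ i<i′)
    ; spoke-hub = spoke-hub
    }

w′-< : ∀ {p k} (F : EOGraph p) (comp : Fin p → Fin k) → All (_< k) (w′ F comp)
w′-< F comp = All.concat⁺ (All.map⁺ (All.map (All.replicate⁺ _)
  (All.map⁺ (All.universal (λ uv → Fin.toℕ<n (comp (proj₁ uv))) (edges F)))))

theorem3p3 : ∀ {p} (F : EOGraph p) (k : ℕ) (comp : Fin p → Fin k) →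
    StarForest F k comp → 1 < k →
    ∀ (n : ℕ) → 0 < n → ∀ (a b : ℕ) →
    IsExOrd n F a → IsExDS n (w′ F comp) b → a ≤ (k ∸ 1) * b
theorem3p3 F (suc (suc j)) comp SF (s≤s (s≤s z≤n)) n _ a b ((G , F-free , eG≡a) , _) (_ , maximal) = begin
  a                                     ≡⟨ eG≡a ⟨
  e G                                   ≤⟨ length≤greedyWord (edges G) (simple G) (distinct G) ⟩
  suc j * length (greedyWord (edges G)) ≤⟨ *-monoʳ-≤ (suc j) (maximal _ admissible) ⟩
  suc j * b                             ∎
  where
  open ≤-Reasoning
  open GreedyWord {n} j
  open StarForestProperties SF using (k≤e)

  avoids-w′ : ¬ ContainsW (greedyWord (edges G)) (w′ F comp)
  avoids-w′ (s , s⊆u , s≈w′) = F-free (SpokesEmbedding.embedding SF (CopyOfW′.spokes F comp G s⊆G s≈w′) room)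
    where
    s⊆G : Sublist Incident s (edges G)
    s⊆G = Sublist.trans (λ { refl incident → incident }) s⊆u (greedyWord-⊆ (edges G))
    room : suc (suc j) + e F ≤ 2 * e F
    room = ≤-trans (+-monoˡ-≤ (e F) k≤e) (≤-reflexive (cong (e F +_) (sym (+-identityʳ (e F)))))

  admissible : DSAdmissible n (w′ F comp) (greedyWord (edges G))
  admissible = Regular-≤ (all<⇒∥∥≤ (w′-< F comp)) (greedyWord-regular (edges G))
             , all<⇒∥∥≤ (greedyWord-< (edges G))
             , avoids-w′
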